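{- Let $X,Y,Z$ be disjoint sets each of size $n$, let $B'\ge1$ be an integer, and let $\Delta=2(6n+1)^{B'}$. For each $v\in X\cup Y\cup Z$ let $b_v$ be an integer chosen independently and uniformly at random from $\{\Delta+1,\dots,2\Delta\}$. Then with probability at least $1/2$, for every $h\in\mathbb{Z}^{X\cup Y\cup Z}$ with $1\le\|h\|_1\le B'$ we have $\sum_{v\in X\cup Y\cup Z}h_vb_v\ne0$. -}

module Defs where

open import Data.Nat as ℕ using (ℕ; _+_; _*_; _^_; _≤_; _<_)
open import Data.Integer as ℤ using (ℤ; ∣_∣)
open import Data.Vec as Vec using (Vec; zipWith; foldr′)
open import Data.Vec.Relation.Unary.All using (All)
open import Data.Product using (_×_)
open import Relation.Binary.PropositionalEquality using (_≡_)
open import Relation.Nullary using (¬_)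

l1norm : ∀ {m} → Vec ℤ m → ℕ
l1norm h = Vec.sum (Vec.map ∣_∣ h)

dot : ∀ {m} → Vec ℤ m → Vec ℕ m → ℤ
dot h b = foldr′ ℤ._+_ (ℤ.+ 0) (zipWith (λ x y → x ℤ.* ℤ.+ y) h b)

Δ : ℕ → ℕ → ℕ
Δ n B′ = 2 * (6 * n + 1) ^ B′

InRange : ∀ {m} → ℕ → Vec ℕ m → Set
InRange D b = All (λ x → D < x × x ≤ 2 * D) b

Good : ∀ {m} → ℕ → Vec ℕ m → Set
Good B′ b = ∀ h → 1 ≤ l1norm h → l1norm h ≤ B′ → ¬ (dot h b ≡ ℤ.+ 0)

{-# OPTIONS --safe #-}
module Submission where

-- Union bound. If h ≠ 0 has a nonzero coordinate c, then for each choice of the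
-- other coordinates of b the equation c·b_v + s = 0 has at most one solution b_v,
-- so a fixed h kills at most a 1/Δ fraction of the outcomes. The ℓ¹ ball of
-- radius B′ in ℤ^m is covered by (2m+1)^B′ vectors, so at most a
-- (2m+1)^B′/Δ = 1/2 fraction of the outcomes is bad when m = 3n.

open import Level using (Level)
open import Function using (_∘_)
open import Data.Nat as ℕ using (ℕ; zero; suc; _+_; _*_; _^_; _≤_; _<_; z≤n; s≤s)
import Data.Nat.Properties as ℕ
open import Data.Nat.ListAction using (sum)
open import Data.Nat.Tactic.RingSolver using (solve-∀)
open import Data.Integer as ℤ using (ℤ; +_; +0; +[1+_]; -[1+_]; 1ℤ; -1ℤ)
import Data.Integer.Properties as ℤ
open import Algebra.Properties.AbelianGroup ℤ.+-0-abelianGroup using (∙-cancelʳ)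
open import Data.Vec as Vec using (Vec; []; _∷_)
import Data.Vec.Properties as Vec
import Data.Vec.Relation.Unary.All as VecAll
open import Data.List as List
  using (List; []; _∷_; [_]; _++_; map; filter; length; applyUpTo; cartesianProductWith)
import Data.List.Properties as List
open import Data.List.Relation.Unary.All as All using (All; []; _∷_)
import Data.List.Relation.Unary.All.Properties as All
open import Data.List.Relation.Unary.Any using (Any; here; any?; toSum; fromSum)
open import Data.List.Relation.Unary.AllPairs using ([]; _∷_)
open import Data.List.Relation.Unary.Unique.Propositional using (Unique)
import Data.List.Relation.Unary.Unique.Propositional.Properties as Unique
open import Data.List.Membership.Propositional using (_∈_; lose)
open import Data.List.Membership.Propositional.Properties using (∈-map⁺; ∈-++⁺ˡ; ∈-++⁺ʳ; ∈-filter⁺)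
open import Data.Product as Product using (_×_; _,_; ∃-syntax)
open import Relation.Binary.PropositionalEquality
  using (_≡_; refl; sym; trans; cong; cong₂; setoid)
open import Relation.Nullary using (¬_; yes; no)
open import Relation.Unary using (Pred; Decidable)
open import Relation.Unary.Properties using (∁?; _∪?_)

open import Defs

open ℕ.≤-Reasoning

private variable
  ℓ₁ ℓ₂ ℓ₃ p q : Level
  A : Set ℓ₁
  B : Set ℓ₂
  C : Set ℓ₃

module _ {P : Pred A p} (P? : Decidable P) where

  length-filter-++ : ∀ xs ys →
    length (filter P? (xs ++ ys)) ≡ length (filter P? xs) + length (filter P? ys)
  length-filter-++ xs ys = trans (cong length (List.filter-++ P? xs ys)) (List.length-++ (filter P? xs))

  length-filter-map : (f : B → A) → ∀ xs → length (filter P? (map f xs)) ≡ length (filter (P? ∘ f) xs)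
  length-filter-map f []       = refl
  length-filter-map f (x ∷ xs) with P? (f x)
  ... | yes _ = cong suc (length-filter-map f xs)
  ... | no _  = length-filter-map f xs

  length-filter-complement : ∀ xs → length (filter P? xs) + length (filter (∁? P?) xs) ≡ length xs
  length-filter-complement []       = refl
  length-filter-complement (x ∷ xs) with P? x
  ... | yes _ = cong suc (length-filter-complement xs)
  ... | no _  = trans (ℕ.+-suc _ _) (cong suc (length-filter-complement xs))

  ∁-at-least-half : ∀ xs → 2 * length (filter P? xs) ≤ length xs →
    length xs ≤ 2 * length (filter (∁? P?) xs)
  ∁-at-least-half xs 2b≤n = begin
    length xs  ≡⟨ length-filter-complement xs ⟨
    b + g      ≤⟨ ℕ.+-monoˡ-≤ g b≤g ⟩
    g + g      ≡⟨ cong (λ k → g + k) (ℕ.+-identityʳ g) ⟨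
    2 * g      ∎
    where
    b = length (filter P? xs)
    g = length (filter (∁? P?) xs)
    b≤g : b ≤ g
    b≤g = ℕ.+-cancelˡ-≤ b b g (begin
      b + b      ≡⟨ cong (λ k → b + k) (ℕ.+-identityʳ b) ⟨
      2 * b      ≤⟨ 2b≤n ⟩
      length xs  ≡⟨ length-filter-complement xs ⟨
      b + g      ∎)

  length-filter≤1 : (∀ {x y} → P x → P y → x ≡ y) → ∀ {xs} → Unique xs → length (filter P? xs) ≤ 1
  length-filter≤1 P-unique []                         = z≤n
  length-filter≤1 P-unique {x ∷ xs} (x∉xs ∷ xs-unique) with P? x
  ... | yes Px = ℕ.≤-reflexive (cong (suc ∘ length)
                   (List.filter-none P? (All.map (λ x≢y Py → x≢y (P-unique Px Py)) x∉xs)))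
  ... | no _   = length-filter≤1 P-unique xs-unique

length-filter-∪ : {P : Pred A p} {Q : Pred A q} (P? : Decidable P) (Q? : Decidable Q) → ∀ xs →
  length (filter (P? ∪? Q?) xs) ≤ length (filter P? xs) + length (filter Q? xs)
length-filter-∪ P? Q? []       = z≤n
length-filter-∪ P? Q? (x ∷ xs) with ih ← length-filter-∪ P? Q? xs | P? x | Q? x
... | yes _ | yes _ = s≤s (ℕ.≤-trans ih (ℕ.+-monoʳ-≤ _ (ℕ.n≤1+n _)))
... | yes _ | no _  = s≤s ih
... | no _  | yes _ = ℕ.≤-trans (s≤s ih) (ℕ.≤-reflexive (sym (ℕ.+-suc _ _)))
... | no _  | no _  = ih

length-filter-any : {Q : B → Pred A q} (Q? : ∀ h → Decidable (Q h)) → ∀ hs xs →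
  length (filter (λ x → any? (λ h → Q? h x) hs) xs) ≤ sum (map (λ h → length (filter (Q? h) xs)) hs)
length-filter-any Q? []       xs =
  ℕ.≤-reflexive (cong length (List.filter-none _ (All.universal (λ _ ()) xs)))
length-filter-any Q? (h ∷ hs) xs = begin
  length (filter (λ x → any? (λ h → Q? h x) (h ∷ hs)) xs)
    ≡⟨ cong length (List.filter-≐ _ (Q? h ∪? any-hs?) (toSum , fromSum) xs) ⟩
  length (filter (Q? h ∪? any-hs?) xs)
    ≤⟨ length-filter-∪ (Q? h) any-hs? xs ⟩
  length (filter (Q? h) xs) + length (filter any-hs? xs)
    ≤⟨ ℕ.+-monoʳ-≤ _ (length-filter-any Q? hs xs) ⟩
  length (filter (Q? h) xs) + sum (map (λ h → length (filter (Q? h) xs)) hs) ∎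
  where
  any-hs? = λ x → any? (λ h → Q? h x) hs

sum-map-*-≤ : (f : A → ℕ) {d w : ℕ} → ∀ {xs} → All (λ x → f x * d ≤ w) xs →
  sum (map f xs) * d ≤ length xs * w
sum-map-*-≤ f                   []                 = z≤n
sum-map-*-≤ f {d} {xs = x ∷ _} (fx*d≤w ∷ bounds) =
  ℕ.≤-trans (ℕ.≤-reflexive (ℕ.*-distribʳ-+ d (f x) _)) (ℕ.+-mono-≤ fx*d≤w (sum-map-*-≤ f bounds))

module _ (f : A → B → C) where

  length-cartesianProductWith : ∀ xs ys → length (cartesianProductWith f xs ys) ≡ length xs * length ys
  length-cartesianProductWith []       ys = refl
  length-cartesianProductWith (x ∷ xs) ys =
    trans (List.length-++ (map (f x) ys))
          (cong₂ _+_ (List.length-map (f x) ys) (length-cartesianProductWith xs ys))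

  module _ {Q : Pred C q} (Q? : Decidable Q) where

    length-filter-cartesianProductWith-∷ : ∀ x xs ys →
      length (filter Q? (cartesianProductWith f (x ∷ xs) ys))
        ≡ length (filter (Q? ∘ f x) ys) + length (filter Q? (cartesianProductWith f xs ys))
    length-filter-cartesianProductWith-∷ x xs ys =
      trans (length-filter-++ Q? (map (f x) ys) _) (cong (_+ _) (length-filter-map Q? (f x) ys))

    length-filter-cartesianProductWith-fibres≤ : ∀ {ys} k → (∀ x → length (filter (Q? ∘ f x) ys) ≤ k) →
      ∀ xs → length (filter Q? (cartesianProductWith f xs ys)) ≤ length xs * k
    length-filter-cartesianProductWith-fibres≤      k fibre []       = z≤n
    length-filter-cartesianProductWith-fibres≤ {ys} k fibre (x ∷ xs) =
      ℕ.≤-trans (ℕ.≤-reflexive (length-filter-cartesianProductWith-∷ x xs ys))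
                (ℕ.+-mono-≤ (fibre x) (length-filter-cartesianProductWith-fibres≤ k fibre xs))

    length-filter-cartesianProductWith-≤ : {P : Pred A p} (P? : Decidable P) → (∀ {x y} → Q (f x y) → P x) →
      ∀ xs ys → length (filter Q? (cartesianProductWith f xs ys)) ≤ length (filter P? xs) * length ys
    length-filter-cartesianProductWith-≤ P? Q⇒P []       ys = z≤n
    length-filter-cartesianProductWith-≤ P? Q⇒P (x ∷ xs) ys
      rewrite length-filter-cartesianProductWith-∷ x xs ys
      with ih ← length-filter-cartesianProductWith-≤ P? Q⇒P xs ys | P? x
    ... | yes _  = ℕ.+-mono-≤ (List.length-filter (Q? ∘ f x) ys) ih
    ... | no ¬Px rewrite List.filter-none (Q? ∘ f x) (All.universal (λ _ → ¬Px ∘ Q⇒P) ys) = ih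

affine-injective : ∀ c .{{_ : ℤ.NonZero c}} s {x y} → c ℤ.* + x ℤ.+ s ≡ c ℤ.* + y ℤ.+ s → x ≡ y
affine-injective c s eq = ℤ.+-injective (ℤ.*-cancelˡ-≡ c _ _ (∙-cancelʳ s _ _ eq))

module _ (D : ℕ) where

  range : List ℕ
  range = applyUpTo (λ i → suc (D + i)) D

  box : (m : ℕ) → List (Vec ℕ m)
  box zero    = [ [] ]
  box (suc m) = cartesianProductWith (λ b x → x ∷ b) (box m) range

  length-range : length range ≡ D
  length-range = List.length-applyUpTo _ D

  range-unique : Unique range
  range-unique =
    Unique.applyUpTo⁺₁ _ D (λ i<j _ eq → ℕ.<⇒≢ i<j (ℕ.+-cancelˡ-≡ D _ _ (ℕ.suc-injective eq)))

  range-inRange : All (λ x → D < x × x ≤ 2 * D) range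
  range-inRange = All.applyUpTo⁺₁ _ D (λ {i} i<D →
    s≤s (ℕ.m≤m+n D i) ,
    ℕ.≤-trans (ℕ.+-monoʳ-< D i<D) (ℕ.≤-reflexive (cong (λ k → D + k) (sym (ℕ.+-identityʳ D)))))

  length-box : ∀ m → length (box m) ≡ D ^ m
  length-box zero    = refl
  length-box (suc m) = trans (length-cartesianProductWith _ (box m) range)
    (trans (cong₂ _*_ (length-box m) length-range) (ℕ.*-comm (D ^ m) D))

  box-unique : ∀ m → Unique (box m)
  box-unique zero    = [] ∷ []
  box-unique (suc m) =
    Unique.cartesianProductWith⁺ _ (Product.swap ∘ Vec.∷-injective) (box-unique m) range-unique

  box-inRange : ∀ m → All (InRange D) (box m)
  box-inRange zero    = VecAll.[] ∷ []
  box-inRange (suc m) = All.cartesianProductWith⁺ (setoid _) (setoid _) _ (box m) range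
    (λ b∈box x∈range → All.lookup range-inRange x∈range VecAll.∷ All.lookup (box-inRange m) b∈box)

  solutions : ∀ {m} → Vec ℤ m → ℤ → List (Vec ℕ m)
  solutions h t = filter (λ b → dot h b ℤ.≟ t) (box _)

  length-solutions-head≢0 : ∀ {m} c .{{_ : ℤ.NonZero c}} (h : Vec ℤ m) t →
    length (solutions (c ∷ h) t) * D ≤ D ^ suc m
  length-solutions-head≢0 {m} c h t = begin
    length (solutions (c ∷ h) t) * D
      ≤⟨ ℕ.*-monoˡ-≤ D (length-filter-cartesianProductWith-fibres≤ _ _ 1 fibre (box m)) ⟩
    length (box m) * 1 * D
      ≡⟨ cong (_* D) (trans (ℕ.*-identityʳ _) (length-box m)) ⟩
    D ^ m * D
      ≡⟨ ℕ.*-comm (D ^ m) D ⟩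
    D ^ suc m ∎
    where
    fibre : ∀ b → length (filter (λ x → dot (c ∷ h) (x ∷ b) ℤ.≟ t) range) ≤ 1
    fibre b =
      length-filter≤1 _ (λ eqx eqy → affine-injective c (dot h b) (trans eqx (sym eqy))) range-unique

  length-solutions : ∀ {m} (h : Vec ℤ m) t → 1 ≤ l1norm h → length (solutions h t) * D ≤ D ^ m
  length-solutions {suc m} (+0 ∷ h) t 1≤‖h‖ = begin
    length (solutions (+0 ∷ h) t) * D
      ≤⟨ ℕ.*-monoˡ-≤ D (length-filter-cartesianProductWith-≤ _ _ (λ b → dot h b ℤ.≟ t)
                         (trans (sym (ℤ.+-identityˡ _))) (box m) range) ⟩
    length (solutions h t) * length range * D
      ≡⟨ cong (λ r → length (solutions h t) * r * D) length-range ⟩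
    length (solutions h t) * D * D
      ≤⟨ ℕ.*-monoˡ-≤ D (length-solutions h t 1≤‖h‖) ⟩
    D ^ m * D
      ≡⟨ ℕ.*-comm (D ^ m) D ⟩
    D ^ suc m ∎
  length-solutions (c@(+[1+ _ ]) ∷ h) t _ = length-solutions-head≢0 c h t
  length-solutions (c@(-[1+ _ ]) ∷ h) t _ = length-solutions-head≢0 c h t

shiftHead : ∀ {m} → ℤ → Vec ℤ (suc m) → Vec ℤ (suc m)
shiftHead d (c ∷ h) = d ℤ.+ c ∷ h

-- A covering of the ℓ¹ ball of radius B, with repetitions.
ball : (m B : ℕ) → List (Vec ℤ m)
ball zero    B       = [ [] ]
ball (suc m) zero    = map (+0 ∷_) (ball m zero)
ball (suc m) (suc B) = map (+0 ∷_) (ball m (suc B))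
                    ++ map (shiftHead 1ℤ) (ball (suc m) B)
                    ++ map (shiftHead -1ℤ) (ball (suc m) B)

∈-ball : ∀ {m B} (h : Vec ℤ m) → l1norm h ≤ B → h ∈ ball m B
∈-ball                 []                 _           = here refl
∈-ball {suc m} {zero}  (+0 ∷ h)           ‖h‖≤0       = ∈-map⁺ (+0 ∷_) (∈-ball h ‖h‖≤0)
∈-ball {suc m} {suc B} (+0 ∷ h)           ‖h‖≤B       = ∈-++⁺ˡ (∈-map⁺ (+0 ∷_) (∈-ball h ‖h‖≤B))
∈-ball {suc m} {suc B} (+[1+ k ] ∷ h)     (s≤s ‖h‖≤B) =
  ∈-++⁺ʳ (map (+0 ∷_) (ball m (suc B)))
    (∈-++⁺ˡ (∈-map⁺ (shiftHead 1ℤ) (∈-ball (+ k ∷ h) ‖h‖≤B)))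
∈-ball {suc m} {suc B} (-[1+ zero ] ∷ h)  (s≤s ‖h‖≤B) =
  ∈-++⁺ʳ (map (+0 ∷_) (ball m (suc B))) (∈-++⁺ʳ (map (shiftHead 1ℤ) (ball (suc m) B))
    (∈-map⁺ (shiftHead -1ℤ) (∈-ball (+0 ∷ h) ‖h‖≤B)))
∈-ball {suc m} {suc B} (-[1+ suc k ] ∷ h) (s≤s ‖h‖≤B) =
  ∈-++⁺ʳ (map (+0 ∷_) (ball m (suc B))) (∈-++⁺ʳ (map (shiftHead 1ℤ) (ball (suc m) B))
    (∈-map⁺ (shiftHead -1ℤ) (∈-ball (-[1+ k ] ∷ h) ‖h‖≤B)))

length-ball : ∀ m B → length (ball m B) ≤ (1 + 2 * m) ^ B
length-ball zero    B       = ℕ.≤-reflexive (sym (ℕ.^-zeroˡ B))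
length-ball (suc m) zero    = ℕ.≤-trans (ℕ.≤-reflexive (List.length-map _ (ball m zero))) (length-ball m zero)
length-ball (suc m) (suc B) = begin
  length (ball (suc m) (suc B))
    ≡⟨ length-split ⟩
  length (ball m (suc B)) + (L + L)
    ≤⟨ ℕ.+-mono-≤ (length-ball m (suc B)) (ℕ.+-mono-≤ (length-ball (suc m) B) (length-ball (suc m) B)) ⟩
  (1 + 2 * m) * (1 + 2 * m) ^ B + (E + E)
    ≤⟨ ℕ.+-monoˡ-≤ (E + E) (ℕ.*-monoʳ-≤ (1 + 2 * m) (ℕ.^-monoˡ-≤ B 1+2m≤1+2[1+m])) ⟩
  (1 + 2 * m) * E + (E + E)
    ≡⟨ grow m E ⟩
  (1 + 2 * suc m) * E ∎
  where
  E = (1 + 2 * suc m) ^ B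
  L = length (ball (suc m) B)
  length-split : length (ball (suc m) (suc B)) ≡ length (ball m (suc B)) + (L + L)
  length-split = trans (List.length-++ (map (+0 ∷_) (ball m (suc B))))
    (cong₂ _+_ (List.length-map (+0 ∷_) (ball m (suc B)))
               (trans (List.length-++ (map (shiftHead 1ℤ) (ball (suc m) B)))
                      (cong₂ _+_ (List.length-map (shiftHead 1ℤ) (ball (suc m) B))
                                 (List.length-map (shiftHead -1ℤ) (ball (suc m) B)))))
  1+2m≤1+2[1+m] : 1 + 2 * m ≤ 1 + 2 * suc m
  1+2m≤1+2[1+m] = ℕ.+-monoʳ-≤ 1 (ℕ.*-monoʳ-≤ 2 (ℕ.n≤1+n m))
  grow : ∀ m E → (1 + 2 * m) * E + (E + E) ≡ (1 + 2 * suc m) * E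
  grow = solve-∀

nonzero-ball : (m B : ℕ) → List (Vec ℤ m)
nonzero-ball m B = filter (λ h → 1 ℕ.≤? l1norm h) (ball m B)

Bad : ∀ {m} → ℕ → Vec ℕ m → Set
Bad {m} B b = Any (λ h → dot h b ≡ +0) (nonzero-ball m B)

bad? : ∀ {m} B → Decidable (Bad {m} B)
bad? B b = any? (λ h → dot h b ℤ.≟ +0) _

¬bad⇒good : ∀ {m} B {b : Vec ℕ m} → ¬ Bad B b → Good B b
¬bad⇒good B ¬bad h 1≤‖h‖ ‖h‖≤B h·b≡0 =
  ¬bad (lose (∈-filter⁺ (λ h → 1 ℕ.≤? l1norm h) (∈-ball h ‖h‖≤B) 1≤‖h‖) h·b≡0)

length-bad : ∀ D m B → length (filter (bad? B) (box D m)) * D ≤ (1 + 2 * m) ^ B * D ^ m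
length-bad D m B = begin
  length (filter (bad? B) (box D m)) * D
    ≤⟨ ℕ.*-monoˡ-≤ D (length-filter-any (λ h b → dot h b ℤ.≟ +0) (nonzero-ball m B) (box D m)) ⟩
  sum (map (λ h → length (solutions D h +0)) (nonzero-ball m B)) * D
    ≤⟨ sum-map-*-≤ _ (All.map (λ {h} → length-solutions D h +0) (All.all-filter _ (ball m B))) ⟩
  length (nonzero-ball m B) * D ^ m
    ≤⟨ ℕ.*-monoˡ-≤ (D ^ m) (ℕ.≤-trans (List.length-filter _ (ball m B)) (length-ball m B)) ⟩
  (1 + 2 * m) ^ B * D ^ m ∎

bad-at-most-half : ∀ D m B → D ≡ 2 * (1 + 2 * m) ^ B →
  2 * length (filter (bad? B) (box D m)) ≤ length (box D m)
bad-at-most-half D m B D≡2P =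
  ℕ.*-cancelʳ-≤ (2 * #bad) (length (box D m)) P {{ℕ.m^n≢0 (1 + 2 * m) B}} (begin
  2 * #bad * P          ≡⟨ trans (cong (_* P) (ℕ.*-comm 2 #bad)) (ℕ.*-assoc #bad 2 P) ⟩
  #bad * (2 * P)        ≡⟨ cong (#bad *_) D≡2P ⟨
  #bad * D              ≤⟨ length-bad D m B ⟩
  P * D ^ m             ≡⟨ cong (P *_) (length-box D m) ⟨
  P * length (box D m)  ≡⟨ ℕ.*-comm P (length (box D m)) ⟩
  length (box D m) * P  ∎)
  where
  P = (1 + 2 * m) ^ B
  #bad = length (filter (bad? B) (box D m))

lemma7p1 : (n B′ : ℕ) → 1 ≤ B′ →
    ∃[ S ] (Unique {A = Vec ℕ (3 * n)} S
           × All (λ b → InRange (Δ n B′) b × Good B′ b) S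
           × Δ n B′ ^ (3 * n) ≤ 2 * length S)
lemma7p1 n B′ _ =
  filter good? (box D m) ,
  Unique.filter⁺ good? (box-unique D m) ,
  All.zip (All.filter⁺ good? (box-inRange D m) , All.map (¬bad⇒good B′) (All.all-filter good? (box D m))) ,
  (begin
    D ^ m
      ≡⟨ length-box D m ⟨
    length (box D m)
      ≤⟨ ∁-at-least-half (bad? B′) (box D m) (bad-at-most-half D m B′ D≡2P) ⟩
    2 * length (filter good? (box D m)) ∎)
  where
  m = 3 * n
  D = Δ n B′
  good? = ∁? (bad? B′)
  D≡2P : D ≡ 2 * (1 + 2 * m) ^ B′
  D≡2P = cong (λ k → 2 * k ^ B′) (trans (ℕ.+-comm (6 * n) 1) (cong suc (ℕ.*-assoc 2 3 n)))
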